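{- Let $\mathcal D$ be a finite set of formulas closed under subformulas and single negations with $\top\in\mathcal D$, let $\Gamma_{\mathcal D}$ be an adequate set with respect to $\mathcal D$, let $\mathfrak M=(W,R,\{S_w:w\in W\},\Vdash)$ be the $\mathsf{ILP_0}$-structure for $\mathcal D$, and let $\sim_{\mathfrak M}$ be the largest bisimulation on $\mathfrak M$. Then the filtration $\widetilde{\mathfrak M}$ of $\mathfrak M$ through $\Gamma_{\mathcal D},\sim_{\mathfrak M}$ satisfies the frame condition $(\mathsf{P_0})_{\mathsf{gen}}$: for all worlds $a,b,c$ and sets $V,Z$ of worlds of $\widetilde{\mathfrak M}$, if $a\widetilde Rb$, $b\widetilde Rc$, $c\widetilde S_aV$ and $\widetilde R[d]\cap Z\neq\emptyset$ for every $d\in V$, then $c\widetilde S_bZ'$ for some $Z'\subseteq Z$.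
   Context: Modal formulas: propositional variables, $\bot$, $\to$, binary $\rhd$; $\Box A:=\neg A\rhd\bot$, $\Diamond A:=\neg\Box\neg A$. $\mathsf{IL}$: axioms all instances of classical tautologies and of $\Box(A\to B)\to(\Box A\to\Box B)$; $\Box(\Box A\to A)\to\Box A$; $\Box(A\to B)\to A\rhd B$; $(A\rhd B)\wedge(B\rhd C)\to A\rhd C$; $(A\rhd C)\wedge(B\rhd C)\to A\vee B\rhd C$; $A\rhd B\to(\Diamond A\to\Diamond B)$; $\Diamond A\rhd A$; rules modus ponens, necessitation. $\mathsf{ILP_0}$ adds all instances of $A\rhd\Diamond B\to\Box(A\rhd B)$. Single negation: ${\sim}\neg C=C$, ${\sim}B=\neg B$ otherwise; $\mathcal D$ closed under single negations means $B\in\mathcal D\Rightarrow{\sim}B\in\mathcal D$. For maximal $\mathsf{ILP_0}$-consistent sets (MCSs) $w,u$ and set $S$: $w\prec_Su$ iff for all finite $S'\subseteq S$ and all $A$, $A\rhd\bigvee_{G\in S'}\neg G\in w$ implies $\neg A,\Box\neg A\in u$; $w\prec u$ iff $w\prec_\emptyset u$. The $\mathsf{ILP_0}$-structure for $\mathcal D$: $W$ = MCSs containing $G\wedge\Box\neg G$ for some $G\in\mathcal D$; $wRu$ iff $w\prec u$; $R[w]=\{x:wRx\}$; $uS_wV$ iff $wRu$, $V\subseteq R[w]$, and for every $S$ with $w\prec_Su$ some $v\in V$ has $w\prec_Sv$; $w\Vdash p$ iff $p\in w$ (it is a generalized Veltman model, with $w\Vdash A\rhd B$ iff every $u$ with $wRu$,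 $u\Vdash A$ has some $V$ with $uS_wV$ and all of $V$ forcing $B$). A set $\Gamma_{\mathcal D}$ is adequate w.r.t. $\mathcal D$ if: it is closed under subformulas; $A\in\Gamma_{\mathcal D}\Rightarrow{\sim}A\in\Gamma_{\mathcal D}$; $\bot\rhd\bot\in\Gamma_{\mathcal D}$; $A\rhd B\in\Gamma_{\mathcal D}$ whenever each of $A,B$ is an antecedent or succedent of some $\rhd$-formula in $\Gamma_{\mathcal D}$; $A\in\mathcal D\Rightarrow\Box\neg A\in\Gamma_{\mathcal D}$. A bisimulation on a generalized Veltman model is a nonempty $Z\subseteq W\times W$ such that if $wZw'$ then: $w,w'$ force the same propositional variables; (forth) if $wRu$ there is $u'$ with $w'Ru'$, $uZu'$ and for every $V'$ with $u'S_{w'}V'$ there is $V$ with $uS_wV$ and each $v\in V$ is $Z$-related to some $v'\in V'$; (back) symmetrically, if $w'Ru'$ there is $u$ with $wRu$, $uZu'$ and for every $V$ with $uS_wV$ there is $V'$ with $u'S_{w'}V'$ and each $v'\in V'$ has some $v\in V$ with $vZv'$. The union $\sim_{\mathfrak M}$ of all bisimulations is the largest bisimulation, an equivalence relation; $[w]$ is the class of $w$ and $\widetilde V=\{[v]:v\in V\}$. The filtration $\widetilde{\mathfrak M}$ has worlds $\widetilde W$; $[w]\widetilde R[u]$ iff there are $w'\in[w]$, $u'\in[u]$ with $w'Ru'$ and some $\Box A\in\Gamma_{\mathcal D}$ with $w'\nVdash\Box A$, $u'\Vdash\Box A$; $[u]\widetilde S_{[w]}\mathcal V$ (for $\mathcal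 V\subseteq\widetilde W$) iff $[w]\widetilde R[u]$, $\mathcal V\subseteq\widetilde R[[w]]$, and for all $w'\in[w]$, $u'\in[u]$ with $w'Ru'$ there is $V'$ with $u'S_{w'}V'$ and $\widetilde{V'}\subseteq\mathcal V$; $[w]\Vdash p$ iff $w\Vdash p$ for $p\in\Gamma_{\mathcal D}$, other variables false. $\widetilde R[\mathcal X]$ denotes the $\widetilde R$-image. -}

module Defs where

open import Level using (Level)
open import Data.Nat using (ℕ)
open import Data.Bool using (Bool; true; false; not; _∨_)
open import Data.List using (List; []; _∷_; map; foldr)
open import Data.List.Membership.Propositional using (_∈_)
open import Data.List.Relation.Unary.All using (All)
open import Data.Product using (Σ; _×_; _,_)
open import Data.Sum using (_⊎_)
open import Data.Empty using (⊥)
open import Relation.Nullary using (¬_)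
open import Relation.Binary.PropositionalEquality using (_≡_)

infixr 5 _⇒_
infix 6 _▷_

data Fm : Set where
  var : ℕ → Fm
  ⊥' : Fm
  _⇒_ : Fm → Fm → Fm
  _▷_ : Fm → Fm → Fm

~¬ : Fm → Fm
~¬ A = A ⇒ ⊥'

⊤' : Fm
⊤' = ~¬ ⊥'

_∨'_ : Fm → Fm → Fm
A ∨' B = ~¬ A ⇒ B

_∧'_ : Fm → Fm → Fm
A ∧' B = ~¬ (A ⇒ ~¬ B)

□ : Fm → Fm
□ A = ~¬ A ▷ ⊥'

◇ : Fm → Fm
◇ A = ~¬ (□ (~¬ A))

∼ : Fm → Fm
∼ (C ⇒ ⊥') = C
∼ B = ~¬ B

⟦_⟧ : Fm → (Fm → Bool) → Bool
⟦ var n ⟧ v = v (var n)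
⟦ ⊥' ⟧ v = false
⟦ A ⇒ B ⟧ v = not (⟦ A ⟧ v) ∨ ⟦ B ⟧ v
⟦ A ▷ B ⟧ v = v (A ▷ B)

Taut : Fm → Set
Taut A = (v : Fm → Bool) → ⟦ A ⟧ v ≡ true

data ⊢ILP₀ : Fm → Set where
  ax-taut : ∀ {A} → Taut A → ⊢ILP₀ A
  ax-K    : ∀ {A B} → ⊢ILP₀ (□ (A ⇒ B) ⇒ (□ A ⇒ □ B))
  ax-L    : ∀ {A} → ⊢ILP₀ (□ (□ A ⇒ A) ⇒ □ A)
  ax-J1   : ∀ {A B} → ⊢ILP₀ (□ (A ⇒ B) ⇒ A ▷ B)
  ax-J2   : ∀ {A B C} → ⊢ILP₀ ((A ▷ B) ∧' (B ▷ C) ⇒ A ▷ C)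
  ax-J3   : ∀ {A B C} → ⊢ILP₀ ((A ▷ C) ∧' (B ▷ C) ⇒ (A ∨' B) ▷ C)
  ax-J4   : ∀ {A B} → ⊢ILP₀ (A ▷ B ⇒ (◇ A ⇒ ◇ B))
  ax-J5   : ∀ {A} → ⊢ILP₀ (◇ A ▷ A)
  ax-P0   : ∀ {A B} → ⊢ILP₀ (A ▷ ◇ B ⇒ □ (A ▷ B))
  mp      : ∀ {A B} → ⊢ILP₀ (A ⇒ B) → ⊢ILP₀ A → ⊢ILP₀ B
  nec     : ∀ {A} → ⊢ILP₀ A → ⊢ILP₀ (□ A)

FmSet : Set₁
FmSet = Fm → Set

⋀ : List Fm → Fm
⋀ = foldr _∧'_ ⊤'

⋁ : List Fm → Fm
⋁ = foldr _∨'_ ⊥'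

Consistent : FmSet → Set
Consistent Γ = ¬ (Σ (List Fm) λ Δ → All Γ Δ × ⊢ILP₀ (⋀ Δ ⇒ ⊥'))

MaxCons : FmSet → Set₁
MaxCons Γ = Consistent Γ ×
  ((Δ : FmSet) → (∀ A → Γ A → Δ A) → Consistent Δ → ∀ A → Δ A → Γ A)

record World (𝒟 : List Fm) : Set₁ where
  field
    set    : FmSet
    maxc   : MaxCons set
    G      : Fm
    G∈𝒟    : G ∈ 𝒟
    hasG   : set (G ∧' □ (~¬ G))
open World public

Prec : ∀ {𝒟} → FmSet → World 𝒟 → World 𝒟 → Set
Prec S w u = (S' : List Fm) → All S S' → (A : Fm) →
  set w (A ▷ ⋁ (map ~¬ S')) → set u (~¬ A) × set u (□ (~¬ A))

R : ∀ {𝒟} → World 𝒟 → World 𝒟 → Set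
R w u = Prec (λ _ → ⊥) w u

WSet : List Fm → Set₂
WSet 𝒟 = World 𝒟 → Set₁

Sw : ∀ {𝒟} → World 𝒟 → World 𝒟 → WSet 𝒟 → Set₁
Sw w u V = R w u × (∀ x → V x → R w x) ×
  ((S : FmSet) → Prec S w u → Σ (World _) λ v → V v × Prec S w v)

_⊩_ : ∀ {𝒟} → World 𝒟 → Fm → Set₂
w ⊩ var n = Level.Lift _ (set w (var n))
w ⊩ ⊥' = Level.Lift _ ⊥
w ⊩ (A ⇒ B) = w ⊩ A → w ⊩ B
w ⊩ (A ▷ B) = ∀ u → R w u → u ⊩ A →
  Σ (WSet _) λ V → Sw w u V × (∀ v → V v → v ⊩ B)

IsBisim : ∀ {𝒟} → (World 𝒟 → World 𝒟 → Set₁) → Set₂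
IsBisim {𝒟} Z =
  (Σ (World 𝒟) λ w → Σ (World 𝒟) λ w' → Z w w') ×
  (∀ w w' → Z w w' →
    (∀ n → (set w (var n) → set w' (var n)) × (set w' (var n) → set w (var n))) ×
    (∀ u → R w u → Σ (World 𝒟) λ u' → R w' u' × Z u u' ×
       (∀ V' → Sw w' u' V' → Σ (WSet 𝒟) λ V → Sw w u V ×
          (∀ v → V v → Σ (World 𝒟) λ v' → V' v' × Z v v'))) ×
    (∀ u' → R w' u' → Σ (World 𝒟) λ u → R w u × Z u u' ×
       (∀ V → Sw w u V → Σ (WSet 𝒟) λ V' → Sw w' u' V' ×
          (∀ v' → V' v' → Σ (World 𝒟) λ v → V v × Z v v'))))

_≈ᴹ_ : ∀ {𝒟} → World 𝒟 → World 𝒟 → Set₂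
_≈ᴹ_ {𝒟} w w' = Σ (World 𝒟 → World 𝒟 → Set₁) λ Z → IsBisim Z × Z w w'

-- The filtration, with worlds [w] represented by w (equality ≈ᴹ) and
-- sets of classes represented by ≈ᴹ-closed predicates on worlds.

WSet₂ : List Fm → Set₃
WSet₂ 𝒟 = World 𝒟 → Set₂

ClosedSet : ∀ {𝒟} → WSet₂ 𝒟 → Set₂
ClosedSet 𝒱 = ∀ x y → x ≈ᴹ y → 𝒱 x → 𝒱 y

R~ : ∀ {𝒟} → FmSet → World 𝒟 → World 𝒟 → Set₂
R~ {𝒟} Γ w u = Σ (World 𝒟) λ w' → Σ (World 𝒟) λ u' →
  w' ≈ᴹ w × u' ≈ᴹ u × R w' u' ×
  Σ Fm λ A → Γ (□ A) × ¬ (w' ⊩ □ A) × (u' ⊩ □ A)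

S~ : ∀ {𝒟} → FmSet → World 𝒟 → World 𝒟 → WSet₂ 𝒟 → Set₂
S~ {𝒟} Γ w u 𝒱 = R~ Γ w u × (∀ x → 𝒱 x → R~ Γ w x) ×
  (∀ w' u' → w' ≈ᴹ w → u' ≈ᴹ u → R w' u' →
     Σ (WSet 𝒟) λ V' → Sw w' u' V' × (∀ v → V' v → 𝒱 v))

SubClosedL : List Fm → Set
SubClosedL 𝒟 = (∀ A B → (A ⇒ B) ∈ 𝒟 → A ∈ 𝒟 × B ∈ 𝒟) ×
               (∀ A B → (A ▷ B) ∈ 𝒟 → A ∈ 𝒟 × B ∈ 𝒟)

NegClosedL : List Fm → Set
NegClosedL 𝒟 = ∀ B → B ∈ 𝒟 → ∼ B ∈ 𝒟

IsPart : FmSet → Fm → Set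
IsPart Γ A = Σ Fm λ C → Γ (A ▷ C) ⊎ Γ (C ▷ A)

Adequate : List Fm → FmSet → Set
Adequate 𝒟 Γ =
  (∀ A B → Γ (A ⇒ B) → Γ A × Γ B) ×
  (∀ A B → Γ (A ▷ B) → Γ A × Γ B) ×
  (∀ A → Γ A → Γ (∼ A)) ×
  Γ (⊥' ▷ ⊥') ×
  (∀ A B → IsPart Γ A → IsPart Γ B → Γ (A ▷ B)) ×
  (∀ A → A ∈ 𝒟 → Γ (□ (~¬ A)))

module Submission where

-- Every filtered relation is witnessed by representatives, so the work happens in 𝔐.
-- The key fact is a selection property given by axiom P₀ (P₀-selection): if a ≺ b ≺ c
-- and c S_a V, then for each S with b ≺_S c there is d ∈ V with a ≺_{S*} d, where S*
-- collects the □¬A with A ▷ ⋁¬S' ∈ b (S' ⊆ S finite); and a ≺_{S*} d forces b ≺_S u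
-- for every R-successor u of d.  Choosing one successor in Z for each d ∈ V thus gives
-- V₁ with c S_b V₁.  The theorem follows by transporting R and S along ∼_𝔐.

open import Defs
open import Level using (lift; lower)
open import Data.Nat using (ℕ; zero; suc)
open import Data.Fin using (Fin; zero; suc)
open import Data.Bool using (Bool; true; false; not; _∨_; _∧_; T)
open import Data.Bool.Properties using (T-∧; T-≡)
open import Data.Vec using (Vec; []; _∷_; lookup) renaming (map to mapᵥ)
open import Data.Vec.Properties using (lookup-map)
open import Data.List using (List; []; _∷_; _++_; map)
open import Data.List.Membership.Propositional using (_∈_)
open import Data.List.Relation.Unary.All using (All; []; _∷_) renaming (map to mapₐ)
open import Data.List.Relation.Unary.All.Properties using (++⁺)
open import Data.Product using (Σ; _×_; _,_; proj₁; proj₂)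
open import Data.Sum using (_⊎_; inj₁; inj₂)
open import Data.Empty using (⊥; ⊥-elim)
open import Function using (Equivalence)
open import Relation.Nullary using (¬_)
open import Relation.Binary.PropositionalEquality using (_≡_; refl; sym; trans; cong₂)

open Equivalence using (to)

variable
  n : ℕ
  𝒟 L : List Fm
  A B C X : Fm
  Γ Δ S : FmSet

-- A schema is a propositional formula over metavariables; it is
-- valid when its truth table is constantly true, and then every instance is a
-- tautology (variables and ▷-formulas of the instance are atoms for ⟦_⟧).

infixr 5 _⇛_

data Schema (n : ℕ) : Set where
  ‵_  : Fin n → Schema n
  ‵⊥  : Schema n
  _⇛_ : Schema n → Schema n → Schema n

-- the connectives of Defs, mirrored so that instances agree definitionally
‵¬ : Schema n → Schema n
‵¬ s = s ⇛ ‵⊥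

_‵∧_ _‵∨_ : Schema n → Schema n → Schema n
s ‵∧ t = ‵¬ (s ⇛ ‵¬ t)
s ‵∨ t = ‵¬ s ⇛ t

p : Schema (suc n)
p = ‵ zero

q : Schema (suc (suc n))
q = ‵ suc zero

r : Schema (suc (suc (suc n)))
r = ‵ suc (suc zero)

_[_] : Schema n → Vec Fm n → Fm
(‵ i) [ σ ] = lookup σ i
‵⊥ [ σ ] = ⊥'
(s ⇛ t) [ σ ] = s [ σ ] ⇒ t [ σ ]

eval : Schema n → Vec Bool n → Bool
eval (‵ i) ρ = lookup ρ i
eval ‵⊥ ρ = false
eval (s ⇛ t) ρ = not (eval s ρ) ∨ eval t ρ

⟦⟧-instance : (s : Schema n) (σ : Vec Fm n) (v : Fm → Bool) →
  ⟦ s [ σ ] ⟧ v ≡ eval s (mapᵥ (λ A → ⟦ A ⟧ v) σ)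
⟦⟧-instance (‵ i) σ v = sym (lookup-map i (λ A → ⟦ A ⟧ v) σ)
⟦⟧-instance ‵⊥ σ v = refl
⟦⟧-instance (s ⇛ t) σ v =
  cong₂ (λ x y → not x ∨ y) (⟦⟧-instance s σ v) (⟦⟧-instance t σ v)

allRows : (n : ℕ) → (Vec Bool n → Bool) → Bool
allRows zero f = f []
allRows (suc n) f = allRows n (λ ρ → f (true ∷ ρ)) ∧ allRows n (λ ρ → f (false ∷ ρ))

allRows-sound : ∀ n (f : Vec Bool n → Bool) → T (allRows n f) → ∀ ρ → T (f ρ)
allRows-sound zero f ok [] = ok
allRows-sound (suc n) f ok (true ∷ ρ) = allRows-sound n _ (proj₁ (to T-∧ ok)) ρ
allRows-sound (suc n) f ok (false ∷ ρ) = allRows-sound n _ (proj₂ (to T-∧ ok)) ρ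

Valid : Schema n → Set
Valid {n} s = T (allRows n (eval s))

-- Instances of valid schemas are axioms; for a closed schema validity is checked by
-- evaluation, so the implicit proof is found automatically.
tautology : (s : Schema n) {_ : Valid s} (σ : Vec Fm n) → ⊢ILP₀ (s [ σ ])
tautology {n} s {ok} σ = ax-taut λ v →
  trans (⟦⟧-instance s σ v) (to T-≡ (allRows-sound n (eval s) ok (mapᵥ (λ A → ⟦ A ⟧ v) σ)))

mp₂ : ⊢ILP₀ (A ⇒ B ⇒ C) → ⊢ILP₀ A → ⊢ILP₀ B → ⊢ILP₀ C
mp₂ h a b = mp (mp h a) b

⇒-refl : ⊢ILP₀ (A ⇒ A)
⇒-refl {A} = tautology (p ⇛ p) (A ∷ [])

⇒-trans : ⊢ILP₀ (A ⇒ B) → ⊢ILP₀ (B ⇒ C) → ⊢ILP₀ (A ⇒ C)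
⇒-trans {A} {B} {C} = mp₂ (tautology ((p ⇛ q) ⇛ (q ⇛ r) ⇛ (p ⇛ r)) (A ∷ B ∷ C ∷ []))

⇒-const : ⊢ILP₀ B → ⊢ILP₀ (A ⇒ B)
⇒-const {B} {A} = mp (tautology (p ⇛ q ⇛ p) (B ∷ A ∷ []))

ex-falso : ⊢ILP₀ (⊥' ⇒ A)
ex-falso {A} = tautology (‵⊥ ⇛ p) (A ∷ [])

¬¬-elim : ⊢ILP₀ (~¬ (~¬ A) ⇒ A)
¬¬-elim {A} = tautology (‵¬ (‵¬ p) ⇛ p) (A ∷ [])

contrapose : ⊢ILP₀ (A ⇒ B) → ⊢ILP₀ (~¬ B ⇒ ~¬ A)
contrapose {A} {B} = mp (tautology ((p ⇛ q) ⇛ (‵¬ q ⇛ ‵¬ p)) (A ∷ B ∷ []))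

∧-intro : ⊢ILP₀ (X ⇒ A) → ⊢ILP₀ (X ⇒ B) → ⊢ILP₀ (X ⇒ A ∧' B)
∧-intro {X} {A} {B} = mp₂ (tautology ((p ⇛ q) ⇛ (p ⇛ r) ⇛ (p ⇛ q ‵∧ r)) (X ∷ A ∷ B ∷ []))

∧-projˡ : ⊢ILP₀ (A ∧' B ⇒ A)
∧-projˡ {A} {B} = tautology (p ‵∧ q ⇛ p) (A ∷ B ∷ [])

∧-projʳ : ⊢ILP₀ (A ∧' B ⇒ B)
∧-projʳ {A} {B} = tautology (p ‵∧ q ⇛ q) (A ∷ B ∷ [])

∨-injˡ : ⊢ILP₀ (A ⇒ A ∨' B)
∨-injˡ {A} {B} = tautology (p ⇛ p ‵∨ q) (A ∷ B ∷ [])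

∨-injʳ : ⊢ILP₀ (B ⇒ A ∨' B)
∨-injʳ {B} {A} = tautology (q ⇛ p ‵∨ q) (A ∷ B ∷ [])

∨-elim : ⊢ILP₀ (A ⇒ C) → ⊢ILP₀ (B ⇒ C) → ⊢ILP₀ (A ∨' B ⇒ C)
∨-elim {A} {C} {B} = mp₂ (tautology ((p ⇛ r) ⇛ (q ⇛ r) ⇛ (p ‵∨ q ⇛ r)) (A ∷ B ∷ C ∷ []))

∧-monoʳ : ⊢ILP₀ (B ⇒ C) → ⊢ILP₀ (A ∧' B ⇒ A ∧' C)
∧-monoʳ h = ∧-intro ∧-projˡ (⇒-trans ∧-projʳ h)

∨-monoʳ : ⊢ILP₀ (B ⇒ C) → ⊢ILP₀ (A ∨' B ⇒ A ∨' C)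
∨-monoʳ h = ∨-elim ∨-injˡ (⇒-trans h ∨-injʳ)

⋀-++ˡ : ∀ L M → ⊢ILP₀ (⋀ (L ++ M) ⇒ ⋀ L)
⋀-++ˡ [] M = ⇒-const ⇒-refl   -- ⋀ [] = ⊤' = ⊥' ⇒ ⊥'
⋀-++ˡ (x ∷ L) M = ∧-monoʳ (⋀-++ˡ L M)

⋀-++ʳ : ∀ L M → ⊢ILP₀ (⋀ (L ++ M) ⇒ ⋀ M)
⋀-++ʳ [] M = ⇒-refl
⋀-++ʳ (x ∷ L) M = ⇒-trans ∧-projʳ (⋀-++ʳ L M)

⋁¬ : List Fm → Fm
⋁¬ S' = ⋁ (map ~¬ S')

⋁¬-++ˡ : ∀ L M → ⊢ILP₀ (⋁¬ L ⇒ ⋁¬ (L ++ M))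
⋁¬-++ˡ [] M = ex-falso
⋁¬-++ˡ (x ∷ L) M = ∨-monoʳ (⋁¬-++ˡ L M)

⋁¬-++ʳ : ∀ L M → ⊢ILP₀ (⋁¬ M ⇒ ⋁¬ (L ++ M))
⋁¬-++ʳ [] M = ⇒-refl
⋁¬-++ʳ (x ∷ L) M = ⇒-trans (⋁¬-++ʳ L M) ∨-injʳ

□-mono : ⊢ILP₀ (A ⇒ B) → ⊢ILP₀ (□ A ⇒ □ B)
□-mono h = mp ax-K (nec h)

◇-mono : ⊢ILP₀ (A ⇒ B) → ⊢ILP₀ (◇ A ⇒ ◇ B)
◇-mono h = contrapose (□-mono (contrapose h))

▷-intro : ⊢ILP₀ (A ⇒ B) → ⊢ILP₀ (A ▷ B)
▷-intro h = mp ax-J1 (nec h)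

Derives : FmSet → Fm → Set
Derives Γ A = Σ (List Fm) λ L → All Γ L × ⊢ILP₀ (⋀ L ⇒ A)

derives-mp : Derives Γ A → ⊢ILP₀ (A ⇒ B) → Derives Γ B
derives-mp (L , L⊆Γ , d) h = L , L⊆Γ , ⇒-trans d h

derives-thm : ⊢ILP₀ A → Derives Γ A
derives-thm h = [] , [] , ⇒-const h

derives-∈ : Γ A → Derives Γ A
derives-∈ {A = A} a = A ∷ [] , a ∷ [] , ∧-projˡ

derives-∧ : Derives Γ A → Derives Γ B → Derives Γ (A ∧' B)
derives-∧ (L , L⊆Γ , d) (M , M⊆Γ , e) =
  L ++ M , ++⁺ L⊆Γ M⊆Γ , ∧-intro (⇒-trans (⋀-++ˡ L M) d) (⇒-trans (⋀-++ʳ L M) e)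

derives-⋀ : (∀ {A} → Δ A → Derives Γ A) → All Δ L → Derives Γ (⋀ L)
derives-⋀ f [] = derives-thm ⇒-refl
derives-⋀ f (a ∷ as) = derives-∧ (f a) (derives-⋀ f as)

-- A maximal consistent set contains everything it derives: adding a derived formula
-- keeps the set consistent.
maxCons-closed : MaxCons Γ → Derives Γ A → Γ A
maxCons-closed {Γ} {A} (consistent , maximal) ΓA =
  maximal Γ⁺ (λ _ → inj₁) consistentΓ⁺ A (inj₂ refl)
  where
  Γ⁺ : FmSet
  Γ⁺ F = Γ F ⊎ F ≡ A
  derives-Γ⁺ : ∀ {F} → Γ⁺ F → Derives Γ F
  derives-Γ⁺ (inj₁ F∈Γ) = derives-∈ F∈Γ
  derives-Γ⁺ (inj₂ refl) = ΓA
  consistentΓ⁺ : Consistent Γ⁺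
  consistentΓ⁺ (L , L⊆Γ⁺ , d) = consistent (derives-mp (derives-⋀ derives-Γ⁺ L⊆Γ⁺) d)

module _ {𝒟 : List Fm} (w : World 𝒟) where

  ∈-thm : ⊢ILP₀ A → set w A
  ∈-thm h = maxCons-closed (maxc w) (derives-thm h)

  ∈-mp : ⊢ILP₀ (A ⇒ B) → set w A → set w B
  ∈-mp h a = maxCons-closed (maxc w) (derives-mp (derives-∈ a) h)

  ∈-mp₂ : ⊢ILP₀ (A ∧' B ⇒ C) → set w A → set w B → set w C
  ∈-mp₂ h a b = maxCons-closed (maxc w) (derives-mp (derives-∧ (derives-∈ a) (derives-∈ b)) h)

  ▷-trans∈ : set w (A ▷ B) → set w (B ▷ C) → set w (A ▷ C)
  ▷-trans∈ = ∈-mp₂ ax-J2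

  ▷-∨∈ : set w (A ▷ C) → set w (B ▷ C) → set w ((A ∨' B) ▷ C)
  ▷-∨∈ = ∈-mp₂ ax-J3

  ▷-monoʳ∈ : ⊢ILP₀ (B ⇒ C) → set w (A ▷ B) → set w (A ▷ C)
  ▷-monoʳ∈ h ab = ▷-trans∈ ab (∈-thm (▷-intro h))

  P₀∈ : set w (A ▷ ◇ B) → set w (□ (A ▷ B))
  P₀∈ = ∈-mp ax-P0

R-□ : {w u : World 𝒟} → R w u → set w (□ A) → set u A × set u (□ A)
R-□ {u = u} wRu h =
  let (u¬¬A , u□¬¬A) = wRu [] [] (~¬ _) h
  in ∈-mp u ¬¬-elim u¬¬A , ∈-mp u (□-mono ¬¬-elim) u□¬¬A

Prec⇒R : {w u : World 𝒟} → Prec S w u → R w u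
Prec⇒R w≺u S' none = w≺u S' (mapₐ (λ ()) none)

-- ≺ is transitive: a ≺ b puts □¬A into b, which then passes ¬A and □¬A on to c
R-trans : {a b c : World 𝒟} → R a b → R b c → R a c
R-trans {b = b} {c} aRb bRc [] [] A h = R-□ {w = b} {c} bRc (proj₂ (aRb [] [] A h))

-- u S_w V entails that V is inhabited (take S = ∅ in the definition)
Sw-inhabited : {w u : World 𝒟} {V : WSet 𝒟} → Sw w u V → Σ (World 𝒟) V
Sw-inhabited (wRu , _ , select) = let (v , v∈V , _) = select (λ _ → ⊥) wRu in v , v∈V

_⊑_ : World 𝒟 → World 𝒟 → Set₁
d ⊑ b = ∀ u → R d u → R b u

□-inherit : {d b : World 𝒟} → d ⊑ b → b ⊩ □ C → d ⊩ □ C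
□-inherit {b = b} d⊑b b⊩□C u dRu u⊩¬C =
  let (V , uSbV , V⊩⊥) = b⊩□C u (d⊑b u dRu) u⊩¬C
      (v , v∈V) = Sw-inhabited {w = b} {u} uSbV
  in ⊥-elim (lower (V⊩⊥ v v∈V))

module _ {Z : World 𝒟 → World 𝒟 → Set₁} (isB : IsBisim Z) where

  ⊩-invariant : ∀ A w w' → Z w w' → (w ⊩ A → w' ⊩ A) × (w' ⊩ A → w ⊩ A)
  ⊩-invariant (var n) w w' z = let (to , from) = proj₁ (proj₂ isB w w' z) n in
    (λ x → lift (to (lower x))) , (λ x → lift (from (lower x)))
  ⊩-invariant ⊥' w w' z = (λ x → x) , (λ x → x)
  ⊩-invariant (A ⇒ B) w w' z =
    let (A→ , A←) = ⊩-invariant A w w' z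
        (B→ , B←) = ⊩-invariant B w w' z
    in (λ f a' → B→ (f (A← a'))) , (λ f a → B← (f (A→ a)))
  ⊩-invariant (A ▷ B) w w' z = forward , backward
    where
    forward : w ⊩ (A ▷ B) → w' ⊩ (A ▷ B)
    forward f u' w'Ru' u'⊩A =
      let (u , wRu , zu , match) = proj₂ (proj₂ (proj₂ isB w w' z)) u' w'Ru'
          (V , uSwV , V⊩B) = f u wRu (proj₂ (⊩-invariant A u u' zu) u'⊩A)
          (V' , u'Sw'V' , V'⊆ZV) = match V uSwV
      in V' , u'Sw'V' , λ v' v'∈V' →
           let (v , v∈V , zv) = V'⊆ZV v' v'∈V' in proj₁ (⊩-invariant B v v' zv) (V⊩B v v∈V)
    backward : w' ⊩ (A ▷ B) → w ⊩ (A ▷ B)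
    backward f u wRu u⊩A =
      let (u' , w'Ru' , zu , match) = proj₁ (proj₂ (proj₂ isB w w' z)) u wRu
          (V' , u'Sw'V' , V'⊩B) = f u' w'Ru' (proj₁ (⊩-invariant A u u' zu) u⊩A)
          (V , uSwV , V⊆ZV') = match V' u'Sw'V'
      in V , uSwV , λ v v∈V →
           let (v' , v'∈V' , zv) = V⊆ZV' v v∈V in proj₂ (⊩-invariant B v v' zv) (V'⊩B v' v'∈V')

≈-⊩ : {w w' : World 𝒟} → w ≈ᴹ w' → w ⊩ A → w' ⊩ A
≈-⊩ {A = A} {w = w} {w'} (Z , isB , z) = proj₁ (⊩-invariant isB A w w' z)

-- ∼_𝔐 is an equivalence: identity, converse and (nonempty) composite of bisimulations
-- are bisimulations.

identity-bisim : World 𝒟 → IsBisim {𝒟} _≡_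
identity-bisim w = (w , w , refl) , λ where
  x _ refl → (λ _ → (λ s → s) , (λ s → s)) ,
    (λ u r → u , r , refl , λ V' sw → V' , sw , λ v v∈V → v , v∈V , refl) ,
    (λ u r → u , r , refl , λ V sw → V , sw , λ v v∈V → v , v∈V , refl)

converse-bisim : {Z : World 𝒟 → World 𝒟 → Set₁} → IsBisim Z → IsBisim (λ x y → Z y x)
converse-bisim ((x , y , zxy) , clauses) = (y , x , zxy) , λ w w' z →
  let (atoms , forth , back) = clauses w' w z
  in (λ n → proj₂ (atoms n) , proj₁ (atoms n)) , back , forth

composite-bisim : {Z₁ Z₂ : World 𝒟 → World 𝒟 → Set₁} {x y z : World 𝒟} →
  IsBisim Z₁ → IsBisim Z₂ → Z₁ x y → Z₂ y z →
  IsBisim (λ x z → Σ (World 𝒟) λ y → Z₁ x y × Z₂ y z)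
composite-bisim {x = x} {y} {z} (_ , clauses₁) (_ , clauses₂) z₁ z₂ =
  (x , z , y , z₁ , z₂) , λ w w'' (w' , p , q) →
  let (atoms₁ , forth₁ , back₁) = clauses₁ w w' p
      (atoms₂ , forth₂ , back₂) = clauses₂ w' w'' q
  in (λ n → (λ s → proj₁ (atoms₂ n) (proj₁ (atoms₁ n) s)) ,
            (λ s → proj₂ (atoms₁ n) (proj₂ (atoms₂ n) s))) ,
     (λ u wRu →
        let (u' , r' , p' , match₁) = forth₁ u wRu
            (u'' , r'' , q' , match₂) = forth₂ u' r'
        in u'' , r'' , (u' , p' , q') , λ V'' sw'' →
             let (V' , sw' , m₂) = match₂ V'' sw''
                 (V , sw , m₁) = match₁ V' sw'
             in V , sw , λ v v∈V →
                  let (v' , v'∈V' , pv) = m₁ v v∈V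
                      (v'' , v''∈V'' , qv) = m₂ v' v'∈V'
                  in v'' , v''∈V'' , (v' , pv , qv)) ,
     (λ u'' w''Ru'' →
        let (u' , r' , q' , match₂) = back₂ u'' w''Ru''
            (u , r , p' , match₁) = back₁ u' r'
        in u , r , (u' , p' , q') , λ V sw →
             let (V' , sw' , m₁) = match₁ V sw
                 (V'' , sw'' , m₂) = match₂ V' sw'
             in V'' , sw'' , λ v'' v''∈V'' →
                  let (v' , v'∈V' , qv) = m₂ v'' v''∈V''
                      (v , v∈V , pv) = m₁ v' v'∈V'
                  in v , v∈V , (v' , pv , qv))

≈-refl : (w : World 𝒟) → w ≈ᴹ w
≈-refl w = _≡_ , identity-bisim w , refl

≈-sym : {w w' : World 𝒟} → w ≈ᴹ w' → w' ≈ᴹ w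
≈-sym (Z , isB , z) = (λ x y → Z y x) , converse-bisim isB , z

≈-trans : {w w' w'' : World 𝒟} → w ≈ᴹ w' → w' ≈ᴹ w'' → w ≈ᴹ w''
≈-trans {w' = w'} (Z₁ , isB₁ , z₁) (Z₂ , isB₂ , z₂) =
  _ , composite-bisim isB₁ isB₂ z₁ z₂ , (w' , z₁ , z₂)

Refines : WSet 𝒟 → WSet 𝒟 → Set₂
Refines {𝒟} V V' = ∀ v → V v → Σ (World 𝒟) λ v' → V' v' × v ≈ᴹ v'

≈-forth : {w w' u : World 𝒟} → w ≈ᴹ w' → R w u →
  Σ (World 𝒟) λ u' → R w' u' × u ≈ᴹ u' ×
    (∀ V' → Sw w' u' V' → Σ (WSet 𝒟) λ V → Sw w u V × Refines V V')
≈-forth {w = w} {w'} (Z , isB , z) wRu =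
  let (u' , w'Ru' , zu , match) = proj₁ (proj₂ (proj₂ isB w w' z)) _ wRu
  in u' , w'Ru' , (Z , isB , zu) , λ V' sw' →
       let (V , sw , m) = match V' sw'
       in V , sw , λ v v∈V → let (v' , v'∈V' , zv) = m v v∈V in v' , v'∈V' , (Z , isB , zv)

refines-closed : {𝒱 : WSet₂ 𝒟} {V V' : WSet 𝒟} → ClosedSet 𝒱 → Refines V V' →
  (∀ v' → V' v' → 𝒱 v') → ∀ v → V v → 𝒱 v
refines-closed closed V⊑V' V'⊆𝒱 v v∈V =
  let (v' , v'∈V' , v≈v') = V⊑V' v v∈V in closed v' v (≈-sym v≈v') (V'⊆𝒱 v' v'∈V')

Gains : FmSet → World 𝒟 → World 𝒟 → Set₂
Gains Γ w u = Σ Fm λ A → Γ (□ A) × ¬ (w ⊩ □ A) × (u ⊩ □ A)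

R~-intro : {w w' u : World 𝒟} → w' ≈ᴹ w → R w' u → Gains Γ w' u → R~ Γ w u
R~-intro {u = u} w'≈w w'Ru gains = _ , u , w'≈w , ≈-refl u , w'Ru , gains

R~-closedʳ : {b x y : World 𝒟} → R~ Γ b x → x ≈ᴹ y → R~ Γ b y
R~-closedʳ (b' , x' , b'≈b , x'≈x , b'Rx' , gains) x≈y =
  b' , x' , b'≈b , ≈-trans x'≈x x≈y , b'Rx' , gains

R~-realize : {d e : World 𝒟} → R~ Γ d e →
  Σ (World 𝒟) λ e₀ → R d e₀ × e ≈ᴹ e₀ × Gains Γ d e₀
R~-realize (d' , e' , d'≈d , e'≈e , d'Re' , C , □C∈Γ , d'⊮□C , e'⊩□C) =
  let (e₀ , dRe₀ , e'≈e₀ , _) = ≈-forth d'≈d d'Re'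
  in e₀ , dRe₀ , ≈-trans (≈-sym e'≈e) e'≈e₀ ,
     C , □C∈Γ , (λ d⊩□C → d'⊮□C (≈-⊩ {A = □ C} (≈-sym d'≈d) d⊩□C)) ,
     ≈-⊩ {A = □ C} e'≈e₀ e'⊩□C

Gains-inherit : {d b e : World 𝒟} → d ⊑ b → Gains Γ d e → Gains Γ b e
Gains-inherit {d = d} {b} d⊑b (C , □C∈Γ , d⊮□C , e⊩□C) =
  C , □C∈Γ , (λ b⊩□C → d⊮□C (□-inherit {d = d} {b} d⊑b b⊩□C)) , e⊩□C

Boxed : World 𝒟 → FmSet → FmSet
Boxed b S F = Σ Fm λ A → Σ (List Fm) λ S' → All S S' × set b (A ▷ ⋁¬ S') × F ≡ □ (~¬ A)

-- ⋁¬L for finite L ⊆ S* implies ◇A for a single A with A ▷ ⋁¬S' ∈ b (by J3)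
Boxed-⋁¬ : (b : World 𝒟) → ∀ L → All (Boxed b S) L →
  Σ Fm λ A → Σ (List Fm) λ S' → All S S' × set b (A ▷ ⋁¬ S') × ⊢ILP₀ (⋁¬ L ⇒ ◇ A)
Boxed-⋁¬ b [] [] = ⊥' , [] , [] , ∈-thm b (▷-intro ⇒-refl) , ex-falso
Boxed-⋁¬ b (_ ∷ L) ((A₀ , S₀ , S₀⊆S , h₀ , refl) ∷ L⊆S*) with Boxed-⋁¬ b L L⊆S*
... | A , S' , S'⊆S , h , ⋁¬L⇒◇A =
  A₀ ∨' A , S₀ ++ S' , ++⁺ S₀⊆S S'⊆S ,
  ▷-∨∈ b (▷-monoʳ∈ b (⋁¬-++ˡ S₀ S') h₀) (▷-monoʳ∈ b (⋁¬-++ʳ S₀ S') h) ,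
  ∨-elim (◇-mono ∨-injˡ) (⇒-trans ⋁¬L⇒◇A (◇-mono ∨-injʳ))

-- b ≺_S c lifts to a ≺_{S*} c: from X ▷ ◇A ∈ a axiom P₀ gives X ▷ A ∈ b
Boxed-lift : {a b c : World 𝒟} → R a b → Prec S b c → Prec (Boxed b S) a c
Boxed-lift {a = a} {b} aRb b≺c L L⊆S* X hX with Boxed-⋁¬ b L L⊆S*
... | A , S' , S'⊆S , h , ⋁¬L⇒◇A =
  b≺c S' S'⊆S X (▷-trans∈ b (proj₁ (R-□ {w = a} {b} aRb (P₀∈ a (▷-monoʳ∈ a ⋁¬L⇒◇A hX)))) h)

-- a ≺_{S*} d makes every R-successor u of d satisfy b ≺_S u: □¬A ∈ d for each relevant A
Boxed-descend : {a b d u : World 𝒟} → Prec (Boxed b S) a d → R d u → Prec S b u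
Boxed-descend {a = a} {d = d} {u} a≺d dRu S' S'⊆S A h =
  let d¬◇A = proj₁ (a≺d (□ (~¬ A) ∷ []) ((A , S' , S'⊆S , h , refl) ∷ []) (◇ A)
                        (∈-thm a (▷-intro ∨-injˡ)))
  in R-□ {w = d} {u} dRu (∈-mp d ¬¬-elim d¬◇A)

P₀-selection : {a b c : World 𝒟} {V : WSet 𝒟} → R a b → R b c → Sw a c V →
  (next : ∀ d → V d → World 𝒟) → (∀ d d∈V → R d (next d d∈V)) →
  Σ (WSet 𝒟) λ V₁ → Sw b c V₁ ×
    (∀ e → V₁ e → Σ (World 𝒟) λ d → Σ (V d) λ d∈V → next d d∈V ≡ e × d ⊑ b)
P₀-selection {𝒟} {a} {b} {c} {V} aRb bRc (_ , _ , select) next step =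
  V₁ , (bRc , V₁⊆R[b] , choose) , λ _ e∈V₁ → e∈V₁
  where
  V₁ : WSet 𝒟
  V₁ e = Σ (World 𝒟) λ d → Σ (V d) λ d∈V → next d d∈V ≡ e × d ⊑ b
  V₁⊆R[b] : ∀ e → V₁ e → R b e
  V₁⊆R[b] _ (d , d∈V , refl , d⊑b) = d⊑b (next d d∈V) (step d d∈V)
  choose : (S : FmSet) → Prec S b c → Σ (World 𝒟) λ e → V₁ e × Prec S b e
  choose S b≺c =
    let (d , d∈V , a≺d) = select (Boxed b S) (Boxed-lift {a = a} {b} {c} aRb b≺c)
        descend = λ u → Boxed-descend {a = a} {b} {d} {u} a≺d
    in next d d∈V , (d , d∈V , refl , λ u dRu → Prec⇒R {w = b} {u} (descend u dRu)) ,
       descend (next d d∈V) (step d d∈V)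

filtered-selection : {a₁ b₁ c₁ b : World 𝒟} {V : WSet 𝒟} {Z : WSet₂ 𝒟} →
  ClosedSet Z → b₁ ≈ᴹ b → R a₁ b₁ → R b₁ c₁ → Sw a₁ c₁ V →
  (∀ d → V d → Σ (World 𝒟) λ e → R~ Γ d e × Z e) →
  Σ (WSet 𝒟) λ V₁ → Sw b₁ c₁ V₁ × (∀ e → V₁ e → Z e × R~ Γ b e)
filtered-selection {𝒟} {Γ} {a₁} {b₁} {c₁} {b} {V} {Z} closedZ b₁≈b a₁Rb₁ b₁Rc₁ c₁Sa₁V hasSucc =
  let (V₁ , c₁Sb₁V₁ , origin) = P₀-selection {a = a₁} {b₁} {c₁} {V} a₁Rb₁ b₁Rc₁ c₁Sa₁V next next-succ
  in V₁ , c₁Sb₁V₁ , λ e e∈V₁ → chosen-in-Z∩R~[b] e (origin e e∈V₁)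
  where
  realized : ∀ d (d∈V : V d) →
    Σ (World 𝒟) λ e₀ → R d e₀ × proj₁ (hasSucc d d∈V) ≈ᴹ e₀ × Gains Γ d e₀
  realized d d∈V = R~-realize {Γ = Γ} {d = d} (proj₁ (proj₂ (hasSucc d d∈V)))
  next : ∀ d → V d → World 𝒟
  next d d∈V = proj₁ (realized d d∈V)
  next-succ : ∀ d d∈V → R d (next d d∈V)
  next-succ d d∈V = proj₁ (proj₂ (realized d d∈V))
  chosen-in-Z∩R~[b] : ∀ e → (Σ (World 𝒟) λ d → Σ (V d) λ d∈V → next d d∈V ≡ e × d ⊑ b₁) →
    Z e × R~ Γ b e
  chosen-in-Z∩R~[b] _ (d , d∈V , refl , d⊑b₁) =
    let (e , _ , e∈Z) = hasSucc d d∈V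
        (e₀ , dRe₀ , e≈e₀ , gains) = realized d d∈V
    in closedZ e e₀ e≈e₀ e∈Z , R~-intro {Γ = Γ} {w = b} {b₁} {e₀} b₁≈b (d⊑b₁ e₀ dRe₀) (Gains-inherit {Γ = Γ} {d = d} {b₁} {e₀} d⊑b₁ gains)

-- (8) The theorem: Z' = Z ∩ R̃[b] works.  Take a witness a₁ R b₁ of a R̃ b.  For
-- representatives b' R c' of [b], [c], move c' along b' ∼ b₁ to c₁ with b₁ R c₁, apply
-- the selection there, and move the resulting set back to c'.
mainTheorem18 : (𝒟 : List Fm) → SubClosedL 𝒟 → NegClosedL 𝒟 → ⊤' ∈ 𝒟 →
    (Γ : FmSet) → Adequate 𝒟 Γ →
    (a b c : World 𝒟) (V Z : WSet₂ 𝒟) → ClosedSet V → ClosedSet Z →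
    R~ Γ a b → R~ Γ b c → S~ Γ a c V →
    (∀ d → V d → Σ (World 𝒟) λ e → R~ Γ d e × Z e) →
    Σ (WSet₂ 𝒟) λ Z' → ClosedSet Z' × (∀ x → Z' x → Z x) × S~ Γ b c Z'
mainTheorem18 𝒟 _ _ _ Γ _ a b c V Z _ closedZ
  (a₁ , b₁ , a₁≈a , b₁≈b , a₁Rb₁ , _) bR~c (_ , _ , c≈Sa≈V) hasSucc =
  Z' , closedZ' , (λ _ → proj₁) , bR~c , (λ _ → proj₂) , represented
  where
  Z' : WSet₂ 𝒟
  Z' x = Z x × R~ Γ b x
  closedZ' : ClosedSet Z'
  closedZ' x y x≈y (x∈Z , bR~x) = closedZ x y x≈y x∈Z , R~-closedʳ {Γ = Γ} {b = b} {x} {y} bR~x x≈y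
  represented : ∀ b' c' → b' ≈ᴹ b → c' ≈ᴹ c → R b' c' →
    Σ (WSet 𝒟) λ V'' → Sw b' c' V'' × (∀ v → V'' v → Z' v)
  represented b' c' b'≈b c'≈c b'Rc' =
    let (c₁ , b₁Rc₁ , c'≈c₁ , transfer) = ≈-forth {w = b'} {b₁} {c'} (≈-trans b'≈b (≈-sym b₁≈b)) b'Rc'
        (V₁' , c₁Sa₁V₁' , V₁'⊆V) =
          c≈Sa≈V a₁ c₁ a₁≈a (≈-trans (≈-sym c'≈c₁) c'≈c) (R-trans {a = a₁} {b₁} {c₁} a₁Rb₁ b₁Rc₁)
        (V₁ , c₁Sb₁V₁ , V₁⊆Z') =
          filtered-selection {Γ = Γ} {a₁} {b₁} {c₁} {b} {V₁'} {Z} closedZ b₁≈b a₁Rb₁ b₁Rc₁ c₁Sa₁V₁'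
            (λ d d∈V₁' → hasSucc d (V₁'⊆V d d∈V₁'))
        (V'' , c'Sb'V'' , V''⊑V₁) = transfer V₁ c₁Sb₁V₁
    in V'' , c'Sb'V'' , refines-closed {𝒱 = Z'} {V''} {V₁} closedZ' V''⊑V₁ V₁⊆Z'
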